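{- Let $x,y\in\Gamma^*$ be reduced words with $\mathrm{al}(x)=\mathrm{al}(y)=A\cup B$, where $A,B\subseteq L$ and $A\times B\subseteq I$. Write $x=x_Ax_B$ and $y=y_Ay_B$ in $G$ with $\mathrm{al}(x_C)=\mathrm{al}(y_C)=C$ for $C\in\{A,B\}$. Then $x$ and $y$ are conjugate in $G$ if and only if $x_C$ and $y_C$ are conjugate in $G$ for both $C\in\{A,B\}$. Moreover, for $C\in\{A,B\}$, $x_C$ and $y_C$ are conjugate in $G$ if and only if they are conjugate in $G_C$.
   Context: Graph product $G=G(L,I;(G_\alpha)_{\alpha\in L})$: $L$ finite, $I\subseteq L\times L$ irreflexive symmetric, $G_\alpha$ non-trivial groups, $G$ the quotient of $\ast_{\alpha\in L}G_\alpha$ by $gh=hg$ for $g\in G_\alpha,h\in G_\beta$, $(\alpha,\beta)\in I$; $D=(L\times L)\setminus I$. $\Gamma_\alpha=G_\alpha\setminus\{1\}$, $\Gamma$ the disjoint union; words over $\Gamma$ represent elements of $G$. For $w=a_1\cdots a_n\in\Gamma^*$, $a_i\in\Gamma_{\alpha_i}$, the dependence graph $D(w)$ has vertices $1,\dots,n$ labelled $a_i$ and arcs $i\to j$ for $i<j$ with $(\alpha_i,\alpha_j)\in D$; $w$ is reduced if no arc of the Hasse diagram of $D(w)$ joins two vertices with labels in the same $\Gamma_\beta$. $\mathrm{al}(w)=\{\alpha\in L: w\text{ contains a letter of }\Gamma_\alpha\}$. For $C\subseteq L$, $G_C$ is the graph product over $C$ with independence relation $I\cap(C\times C)$ and node groups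 $G_\alpha$, $\alpha\in C$, viewed as the subgroup of $G$ generated by these node groups. -}

module Defs where

open import Level using (Level; _⊔_)
open import Data.Nat using (ℕ)
open import Data.Fin using (Fin) renaming (_<_ to _<ᶠ_)
open import Data.Fin.Subset using (Subset; _∈_; ⊤)
open import Data.List using (List; []; _∷_; _++_; map; reverse; length; lookup)
open import Data.List.Relation.Unary.All using (All)
open import Data.List.Relation.Unary.Any using (Any)
open import Data.Product using (Σ; ∃; _×_; _,_; proj₁)
open import Relation.Nullary using (¬_)
open import Relation.Binary.PropositionalEquality using (_≡_)
open import Function.Bundles using (_⇔_)
open import Algebra.Bundles using (Group)
import Algebra.Properties.Group as GProps

-- Graph product over the vertex set L = Fin n with independence relation I
-- and node groups G α.  The group G(L,I;(G_α)) is presented as the quotient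
-- of the free monoid Γ* by the congruence generated by the usual rewriting
-- relations; since Agda has no quotients we work with words and this
-- congruence.  For a subset C ⊆ L the congruence ≋[ C ] only uses words with
-- letters in C, i.e. it is the equality of the graph product G_C over C
-- (independence I ∩ (C × C)).  ≋[ ⊤ ] is the equality of G itself.
module GP {c ℓ : Level} {n : ℕ} (I : Fin n → Fin n → Set) (G : Fin n → Group c ℓ) where

  open Group using (Carrier; _≈_; _∙_; ε; _⁻¹)

  -- Γ_α = G_α ∖ {1}; Γ is the disjoint union
  Letter : Set (c ⊔ ℓ)
  Letter = Σ (Fin n) λ α → Σ (Carrier (G α)) λ g → ¬ (_≈_ (G α) g (ε (G α)))

  Word : Set (c ⊔ ℓ)
  Word = List Letter

  node : Letter → Fin n
  node = proj₁

  AllIn : Subset n → Word → Set (c ⊔ ℓ)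
  AllIn C w = All (λ a → node a ∈ C) w

  data Step : Word → Word → Set (c ⊔ ℓ) where
    merge   : ∀ u v α g h k p q r → _≈_ (G α) (_∙_ (G α) g h) k →
              Step (u ++ (α , g , p) ∷ (α , h , q) ∷ v) (u ++ (α , k , r) ∷ v)
    cancel  : ∀ u v α g h p q → _≈_ (G α) (_∙_ (G α) g h) (ε (G α)) →
              Step (u ++ (α , g , p) ∷ (α , h , q) ∷ v) (u ++ v)
    swap    : ∀ u v α β g h p q → I α β →
              Step (u ++ (α , g , p) ∷ (β , h , q) ∷ v) (u ++ (β , h , q) ∷ (α , g , p) ∷ v)
    relabel : ∀ u v α g h p q → _≈_ (G α) g h →
              Step (u ++ (α , g , p) ∷ v) (u ++ (α , h , q) ∷ v)

  data _≋[_]_ : Word → Subset n → Word → Set (c ⊔ ℓ) where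
    step  : ∀ {C u v} → AllIn C u → AllIn C v → Step u v → u ≋[ C ] v
    refl  : ∀ {C u} → AllIn C u → u ≋[ C ] u
    sym   : ∀ {C u v} → u ≋[ C ] v → v ≋[ C ] u
    trans : ∀ {C u v w} → u ≋[ C ] v → v ≋[ C ] w → u ≋[ C ] w

  _≋_ : Word → Word → Set (c ⊔ ℓ)
  u ≋ v = u ≋[ ⊤ ] v

  invL : Letter → Letter
  invL (α , g , p) = α , _⁻¹ (G α) g , λ e → p (lem e)
    where
      open GProps (G α)
      open Group (G α) using (setoid)
      open import Relation.Binary.Reasoning.Setoid setoid
      lem : _≈_ (G α) (_⁻¹ (G α) g) (ε (G α)) → _≈_ (G α) g (ε (G α))
      lem e = begin
        g                          ≈⟨ Group.sym (G α) (⁻¹-involutive g) ⟩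
        _⁻¹ (G α) (_⁻¹ (G α) g)    ≈⟨ Group.⁻¹-cong (G α) e ⟩
        _⁻¹ (G α) (ε (G α))        ≈⟨ ε⁻¹≈ε ⟩
        ε (G α)                    ∎

  invW : Word → Word
  invW w = reverse (map invL w)

  ConjIn : Subset n → Word → Word → Set (c ⊔ ℓ)
  ConjIn C x y = Σ Word λ z → AllIn C z × ((invW z ++ x ++ z) ≋[ C ] y)

  Conj : Word → Word → Set (c ⊔ ℓ)
  Conj = ConjIn ⊤

  _∈al_ : Fin n → Word → Set (c ⊔ ℓ)
  α ∈al w = Any (λ a → node a ≡ α) w

  HasAl : Word → Subset n → Set (c ⊔ ℓ)
  HasAl w C = ∀ α → (α ∈al w) ⇔ (α ∈ C)

  D : Fin n → Fin n → Set
  D α β = ¬ I α β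

  module _ (w : Word) where
    nd : Fin (length w) → Fin n
    nd i = node (lookup w i)

    Arc : Fin (length w) → Fin (length w) → Set
    Arc i j = (i <ᶠ j) × D (nd i) (nd j)

    HasseArc : Fin (length w) → Fin (length w) → Set
    HasseArc i j = Arc i j × ¬ (∃ λ k → Arc i k × Arc k j)

  Reduced : Word → Set
  Reduced w = ∀ i j → HasseArc w i j → ¬ (nd w i ≡ nd w j)

module Submission where

-- The argument rests on two facts about the graph product G and a subset C of
-- the vertices.
--   * G_C is a retract of G: deleting every letter outside C is a well-defined
--     homomorphism π_C : G → G_C (each rewriting step of G is mapped to at most
--     one rewriting step of G_C) which fixes every word over C.  Applying π_C to
--     a conjugation z⁻¹ x z = y in G gives a conjugation in G_C, so words over C
--     are conjugate in G iff they are conjugate in G_C.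
--   * If A × B ⊆ I then words over A commute with words over B in G.
-- For x = x_A x_B and y = y_A y_B, projecting a conjugation x ~ y with π_A and
-- π_B yields x_A ~ y_A and x_B ~ y_B (π_A kills x_B since A ∩ B = ∅ by
-- irreflexivity of I).  Conversely, if a conjugates x_A to y_A inside G_A and
-- b conjugates x_B to y_B inside G_B, then ab conjugates x_A x_B to y_A y_B,
-- by commuting the B-parts past the A-parts.

open import Defs
open import Level using (Level)
open import Data.Nat using (ℕ)
open import Data.Fin using (Fin)
open import Data.Fin.Subset using (Subset; _∈_; _∪_; ⊤)
open import Data.Fin.Subset.Properties using (_∈?_; ∈⊤)
open import Data.List using (List; []; _∷_; _++_; [_]; reverse; map; filter)
open import Data.List.Properties
  using (++-monoid; ++-identityʳ; unfold-reverse; map-++; reverse-++; filter-++; filter-all; filter-none; filter-accept; filter-reject)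
open import Data.List.Relation.Unary.All using (All; []; _∷_)
import Data.List.Relation.Unary.All as All
open import Data.List.Relation.Unary.All.Properties using (++⁺; all-filter)
open import Data.List.Relation.Unary.Any using (here; there)
open import Data.Product using (∃; _×_; _,_)
open import Relation.Nullary using (¬_; Dec; yes; no)
open import Relation.Unary using (Pred; Decidable)
open import Function.Bundles using (_⇔_; mk⇔; Equivalence)
open import Algebra.Bundles using (Group)
open import Relation.Binary.Bundles using (Setoid)
import Relation.Binary.Reasoning.Setoid as SetoidReasoning
open import Relation.Binary.PropositionalEquality as ≡ using (_≡_; subst; subst₂)
open import Tactic.MonoidSolver using (solve)

-- Filtering commutes with reversal (for any decidable predicate); this is what
-- makes the projection π_C below commute with inversion of words.
filter-reverse : ∀ {a p} {X : Set a} {P : Pred X p} (P? : Decidable P) (xs : List X) →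
                 filter P? (reverse xs) ≡ reverse (filter P? xs)
filter-reverse P? [] = ≡.refl
filter-reverse P? (x ∷ xs) with P? x
... | yes px = begin
  filter P? (reverse (x ∷ xs))               ≡⟨ ≡.cong (filter P?) (unfold-reverse x xs) ⟩
  filter P? (reverse xs ++ [ x ])            ≡⟨ filter-++ P? (reverse xs) [ x ] ⟩
  filter P? (reverse xs) ++ filter P? [ x ]  ≡⟨ ≡.cong₂ _++_ (filter-reverse P? xs) (filter-accept P? px) ⟩
  reverse (filter P? xs) ++ [ x ]            ≡⟨ unfold-reverse x (filter P? xs) ⟨
  reverse (x ∷ filter P? xs)                 ∎
  where open ≡.≡-Reasoning
... | no ¬px = begin
  filter P? (reverse (x ∷ xs))               ≡⟨ ≡.cong (filter P?) (unfold-reverse x xs) ⟩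
  filter P? (reverse xs ++ [ x ])            ≡⟨ filter-++ P? (reverse xs) [ x ] ⟩
  filter P? (reverse xs) ++ filter P? [ x ]  ≡⟨ ≡.cong₂ _++_ (filter-reverse P? xs) (filter-reject P? ¬px) ⟩
  reverse (filter P? xs) ++ []               ≡⟨ ++-identityʳ _ ⟩
  reverse (filter P? xs)                     ∎
  where open ≡.≡-Reasoning

module GraphProductWords {c ℓ : Level} {n : ℕ} (I : Fin n → Fin n → Set) (G : Fin n → Group c ℓ) where
  open GP I G

  private
    variable
      C : Subset n
      u v w x y x′ y′ : Word

  over-⊤ : ∀ w → AllIn ⊤ w
  over-⊤ [] = []
  over-⊤ (a ∷ w) = ∈⊤ ∷ over-⊤ w

  alphabet-within : (∀ α → α ∈al w → α ∈ C) → AllIn C w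
  alphabet-within {[]} h = []
  alphabet-within {a ∷ w} h = h (node a) (here ≡.refl) ∷ alphabet-within (λ α m → h α (there m))

  over-alphabet : HasAl w C → AllIn C w
  over-alphabet h = alphabet-within (λ α → Equivalence.to (h α))

  ≋-setoid : Setoid (c Level.⊔ ℓ) (c Level.⊔ ℓ)
  ≋-setoid = record
    { Carrier = Word
    ; _≈_ = _≋_
    ; isEquivalence = record { refl = refl (over-⊤ _) ; sym = sym ; trans = trans }
    }

  ≋-step : Step u v → u ≋ v
  ≋-step s = step (over-⊤ _) (over-⊤ _) s

  ≋-weaken : u ≋[ C ] v → u ≋ v
  ≋-weaken (step _ _ s) = ≋-step s
  ≋-weaken (refl _) = refl (over-⊤ _)
  ≋-weaken (sym e) = sym (≋-weaken e)
  ≋-weaken (trans e f) = trans (≋-weaken e) (≋-weaken f)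

  redex-in-context : ∀ p u s v q → (p ++ u) ++ s ++ v ++ q ≡ p ++ (u ++ s ++ v) ++ q
  redex-in-context p u s v q = solve (++-monoid Letter)

  step-in-context : ∀ p q → Step u v → Step (p ++ u ++ q) (p ++ v ++ q)
  step-in-context p q (merge u v α g h k a b r e) =
    subst₂ Step (redex-in-context p u _ v q) (redex-in-context p u _ v q)
      (merge (p ++ u) (v ++ q) α g h k a b r e)
  step-in-context p q (cancel u v α g h a b e) =
    subst₂ Step (redex-in-context p u _ v q) (redex-in-context p u [] v q)
      (cancel (p ++ u) (v ++ q) α g h a b e)
  step-in-context p q (swap u v α β g h a b i) =
    subst₂ Step (redex-in-context p u _ v q) (redex-in-context p u _ v q)
      (swap (p ++ u) (v ++ q) α β g h a b i)
  step-in-context p q (relabel u v α g h a b e) =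
    subst₂ Step (redex-in-context p u _ v q) (redex-in-context p u _ v q)
      (relabel (p ++ u) (v ++ q) α g h a b e)

  ≋-cong : ∀ {p q} → AllIn C p → AllIn C q → u ≋[ C ] v → (p ++ u ++ q) ≋[ C ] (p ++ v ++ q)
  ≋-cong {p = p} {q} p∈C q∈C (step u∈C v∈C s) =
    step (++⁺ p∈C (++⁺ u∈C q∈C)) (++⁺ p∈C (++⁺ v∈C q∈C)) (step-in-context p q s)
  ≋-cong p∈C q∈C (refl u∈C) = refl (++⁺ p∈C (++⁺ u∈C q∈C))
  ≋-cong p∈C q∈C (sym e) = sym (≋-cong p∈C q∈C e)
  ≋-cong p∈C q∈C (trans e f) = trans (≋-cong p∈C q∈C e) (≋-cong p∈C q∈C f)

  ≋-sandwich : ∀ p q → u ≋ v → (p ++ u ++ q) ≋ (p ++ v ++ q)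
  ≋-sandwich p q = ≋-cong (over-⊤ p) (over-⊤ q)

  ≋-prefix : ∀ p → u ≋ v → (p ++ u) ≋ (p ++ v)
  ≋-prefix {u} {v} p e =
    subst₂ _≋_ (≡.cong (p ++_) (++-identityʳ u)) (≡.cong (p ++_) (++-identityʳ v)) (≋-sandwich p [] e)

  π : Subset n → Word → Word
  π C = filter (λ a → node a ∈? C)

  π-++ : ∀ C u v → π C (u ++ v) ≡ π C u ++ π C v
  π-++ C = filter-++ (λ a → node a ∈? C)

  π-over : ∀ C w → AllIn C (π C w)
  π-over C = all-filter (λ a → node a ∈? C)

  π-fixes : AllIn C w → π C w ≡ w
  π-fixes {C} = filter-all (λ a → node a ∈? C)

  Avoids : Subset n → Word → Set (c Level.⊔ ℓ)
  Avoids C w = All (λ a → ¬ (node a ∈ C)) w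

  π-deletes : Avoids C w → π C w ≡ []
  π-deletes {C} = filter-none (λ a → node a ∈? C)

  -- π_C commutes with inversion of words (inverting a letter keeps its node).
  π-invW : ∀ C w → π C (invW w) ≡ invW (π C w)
  π-invW C w = ≡.trans (filter-reverse (λ a → node a ∈? C) (map invL w)) (≡.cong reverse (π-map-invL w))
    where
      π-map-invL : ∀ w → π C (map invL w) ≡ map invL (π C w)
      π-map-invL [] = ≡.refl
      π-map-invL (a ∷ w) with node a ∈? C
      ... | yes _ = ≡.cong (invL a ∷_) (π-map-invL w)
      ... | no _ = π-map-invL w

  invW-over : AllIn C w → AllIn C (invW w)
  invW-over {C} {w} w∈C = subst (AllIn C) (≡.trans (π-invW C w) (≡.cong invW (π-fixes w∈C))) (π-over C (invW w))

  π-in-context : ∀ C u s t v → π C s ≋[ C ] π C t → π C (u ++ s ++ v) ≋[ C ] π C (u ++ t ++ v)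
  π-in-context C u s t v e =
    subst₂ _≋[ C ]_ (≡.sym (π-++³ s)) (≡.sym (π-++³ t)) (≋-cong (π-over C u) (π-over C v) e)
    where
      π-++³ : ∀ s → π C (u ++ s ++ v) ≡ π C u ++ π C s ++ π C v
      π-++³ s = ≡.trans (π-++ C u (s ++ v)) (≡.cong (π C u ++_) (π-++ C s v))

  -- A redex over C is mapped to itself, so a step on it remains a step of G_C.
  π-visible : AllIn C u → AllIn C v → Step u v → π C u ≋[ C ] π C v
  π-visible {C = C} u∈C v∈C s = subst₂ _≋[ C ]_ (≡.sym (π-fixes u∈C)) (≡.sym (π-fixes v∈C)) (step u∈C v∈C s)

  π-invisible : ∀ C u v → π C u ≡ π C v → π C u ≋[ C ] π C v
  π-invisible C u v e = subst (π C u ≋[ C ]_) e (refl (π-over C u))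

  π-hidden : ∀ C u v → Avoids C u → Avoids C v → π C u ≋[ C ] π C v
  π-hidden C u v u∉C v∉C = π-invisible C u v (≡.trans (π-deletes u∉C) (≡.sym (π-deletes v∉C)))

  π-swap-outside : ∀ C a b → ¬ (node b ∈ C) → π C (a ∷ b ∷ []) ≡ π C (b ∷ a ∷ [])
  π-swap-outside C a b b∉C = begin
    π C ([ a ] ++ [ b ])    ≡⟨ π-++ C [ a ] [ b ] ⟩
    π C [ a ] ++ π C [ b ]  ≡⟨ ≡.cong (π C [ a ] ++_) (π-deletes (b∉C ∷ [])) ⟩
    π C [ a ] ++ []         ≡⟨ ++-identityʳ _ ⟩
    π C [ a ]               ≡⟨ filter-reject (λ a → node a ∈? C) b∉C ⟨
    π C (b ∷ a ∷ [])        ∎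
    where open ≡.≡-Reasoning

  π-step : ∀ C → Step u v → π C u ≋[ C ] π C v
  π-step C (merge u v α g h k p q r e) = π-in-context C u s t v (redex (α ∈? C))
    where
      s t : Word
      s = (α , g , p) ∷ (α , h , q) ∷ []
      t = (α , k , r) ∷ []
      redex : Dec (α ∈ C) → π C s ≋[ C ] π C t
      redex (yes α∈C) = π-visible (α∈C ∷ α∈C ∷ []) (α∈C ∷ []) (merge [] [] α g h k p q r e)
      redex (no α∉C) = π-hidden C s t (α∉C ∷ α∉C ∷ []) (α∉C ∷ [])
  π-step C (cancel u v α g h p q e) = π-in-context C u s [] v (redex (α ∈? C))
    where
      s : Word
      s = (α , g , p) ∷ (α , h , q) ∷ []
      redex : Dec (α ∈ C) → π C s ≋[ C ] π C []
      redex (yes α∈C) = π-visible (α∈C ∷ α∈C ∷ []) [] (cancel [] [] α g h p q e)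
      redex (no α∉C) = π-hidden C s [] (α∉C ∷ α∉C ∷ []) []
  π-step C (swap u v α β g h p q i) = π-in-context C u (a ∷ b ∷ []) (b ∷ a ∷ []) v (redex (α ∈? C) (β ∈? C))
    where
      a b : Letter
      a = α , g , p
      b = β , h , q
      redex : Dec (α ∈ C) → Dec (β ∈ C) → π C (a ∷ b ∷ []) ≋[ C ] π C (b ∷ a ∷ [])
      redex (yes α∈C) (yes β∈C) = π-visible (α∈C ∷ β∈C ∷ []) (β∈C ∷ α∈C ∷ []) (swap [] [] α β g h p q i)
      redex _ (no β∉C) = π-invisible C (a ∷ b ∷ []) (b ∷ a ∷ []) (π-swap-outside C a b β∉C)
      redex (no α∉C) (yes _) = π-invisible C (a ∷ b ∷ []) (b ∷ a ∷ []) (≡.sym (π-swap-outside C b a α∉C))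
  π-step C (relabel u v α g h p q e) = π-in-context C u s t v (redex (α ∈? C))
    where
      s t : Word
      s = (α , g , p) ∷ []
      t = (α , h , q) ∷ []
      redex : Dec (α ∈ C) → π C s ≋[ C ] π C t
      redex (yes α∈C) = π-visible (α∈C ∷ []) (α∈C ∷ []) (relabel [] [] α g h p q e)
      redex (no α∉C) = π-hidden C s t (α∉C ∷ []) (α∉C ∷ [])

  π-≋ : ∀ C {D} → u ≋[ D ] v → π C u ≋[ C ] π C v
  π-≋ C (step _ _ s) = π-step C s
  π-≋ {u} C (refl _) = refl (π-over C u)
  π-≋ C (sym e) = sym (π-≋ C e)
  π-≋ C (trans e f) = trans (π-≋ C e) (π-≋ C f)

  invW-++ : ∀ u v → invW (u ++ v) ≡ invW v ++ invW u
  invW-++ u v = ≡.trans (≡.cong reverse (map-++ invL u v)) (reverse-++ (map invL u) (map invL v))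

  conjIn⇒conj : ConjIn C x y → Conj x y
  conjIn⇒conj (z , _ , e) = z , over-⊤ z , ≋-weaken e

  π-conj : ∀ C → Conj x y → ConjIn C (π C x) (π C y)
  π-conj {x} {y} C (z , _ , e) = π C z , π-over C z , subst (_≋[ C ] π C y) π-conjugate (π-≋ C e)
    where
      π-conjugate : π C (invW z ++ x ++ z) ≡ invW (π C z) ++ π C x ++ π C z
      π-conjugate = begin
        π C (invW z ++ x ++ z)            ≡⟨ π-++ C (invW z) (x ++ z) ⟩
        π C (invW z) ++ π C (x ++ z)      ≡⟨ ≡.cong₂ _++_ (π-invW C z) (π-++ C x z) ⟩
        invW (π C z) ++ π C x ++ π C z    ∎
        where open ≡.≡-Reasoning

  conj⇔conjIn : AllIn C x → AllIn C y → Conj x y ⇔ ConjIn C x y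
  conj⇔conjIn {C} x∈C y∈C =
    mk⇔ (λ c → subst₂ (ConjIn C) (π-fixes x∈C) (π-fixes y∈C) (π-conj C c)) conjIn⇒conj

  conj-resp : Conj x y → x ≋ x′ → y ≋ y′ → Conj x′ y′
  conj-resp (z , _ , e) x≋x′ y≋y′ = z , over-⊤ z , trans (≋-sandwich (invW z) z (sym x≋x′)) (trans e y≋y′)

  π-factorˡ : x ≋ (u ++ v) → AllIn C u → Avoids C v → π C x ≋ u
  π-factorˡ {u = u} {v} {C} x≋uv u∈C v∉C = trans (≋-weaken (π-≋ C x≋uv)) (Setoid.reflexive ≋-setoid (begin
    π C (u ++ v)       ≡⟨ π-++ C u v ⟩
    π C u ++ π C v     ≡⟨ ≡.cong₂ _++_ (π-fixes u∈C) (π-deletes v∉C) ⟩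
    u ++ []            ≡⟨ ++-identityʳ u ⟩
    u                  ∎))
    where open ≡.≡-Reasoning

  π-factorʳ : x ≋ (u ++ v) → Avoids C u → AllIn C v → π C x ≋ v
  π-factorʳ {u = u} {v} {C} x≋uv u∉C v∈C = trans (≋-weaken (π-≋ C x≋uv)) (Setoid.reflexive ≋-setoid (begin
    π C (u ++ v)       ≡⟨ π-++ C u v ⟩
    π C u ++ π C v     ≡⟨ ≡.cong₂ _++_ (π-deletes u∉C) (π-fixes v∈C) ⟩
    v                  ∎))
    where open ≡.≡-Reasoning

  avoids-disjoint : ∀ {D} → (∀ α → α ∈ D → ¬ (α ∈ C)) → AllIn D w → Avoids C w
  avoids-disjoint D∩C=∅ = All.map (λ {a} → D∩C=∅ (node a))

  module Independent (A B : Subset n) (A×B⊆I : ∀ α β → α ∈ A → β ∈ B → I α β) where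
    open SetoidReasoning ≋-setoid

    disjoint : (∀ α → ¬ I α α) → ∀ α → α ∈ A → ¬ (α ∈ B)
    disjoint irrefl α α∈A α∈B = irrefl α (A×B⊆I α α α∈A α∈B)

    letter-comm : ∀ a v → node a ∈ A → AllIn B v → (a ∷ v) ≋ (v ++ [ a ])
    letter-comm a [] _ [] = refl (over-⊤ [ a ])
    letter-comm a@(α , g , p) (b@(β , h , q) ∷ v) α∈A (β∈B ∷ v∈B) = begin
      a ∷ b ∷ v        ≈⟨ ≋-step (swap [] v α β g h p q (A×B⊆I α β α∈A β∈B)) ⟩
      b ∷ a ∷ v        ≈⟨ ≋-prefix [ b ] (letter-comm a v α∈A v∈B) ⟩
      b ∷ v ++ [ a ]   ∎

    comm : AllIn A u → AllIn B v → (u ++ v) ≋ (v ++ u)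
    comm {[]} {v} [] _ = Setoid.reflexive ≋-setoid (≡.sym (++-identityʳ v))
    comm {a ∷ u} {v} (α∈A ∷ u∈A) v∈B = begin
      a ∷ u ++ v          ≈⟨ ≋-prefix [ a ] (comm u∈A v∈B) ⟩
      a ∷ v ++ u          ≈⟨ ≋-sandwich [] u (letter-comm a v α∈A v∈B) ⟩
      (v ++ [ a ]) ++ u   ≡⟨ solve (++-monoid Letter) ⟩
      v ++ a ∷ u          ∎

    conj-product : ∀ {a b xA xB yA yB} → AllIn A a → AllIn B b → AllIn B xB → AllIn A yA →
                   (invW a ++ xA ++ a) ≋ yA → (invW b ++ xB ++ b) ≋ yB →
                   (invW (a ++ b) ++ (xA ++ xB) ++ (a ++ b)) ≋ (yA ++ yB)
    conj-product {a} {b} {xA} {xB} {yA} {yB} a∈A b∈B xB∈B yA∈A a-conj b-conj = begin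
      invW (a ++ b) ++ (xA ++ xB) ++ (a ++ b)        ≡⟨ ≡.cong (_++ ((xA ++ xB) ++ (a ++ b))) (invW-++ a b) ⟩
      (invW b ++ invW a) ++ (xA ++ xB) ++ (a ++ b)   ≡⟨ solve (++-monoid Letter) ⟩
      (invW b ++ invW a ++ xA) ++ (xB ++ a) ++ b     ≈⟨ ≋-sandwich (invW b ++ invW a ++ xA) b (sym (comm a∈A xB∈B)) ⟩
      (invW b ++ invW a ++ xA) ++ (a ++ xB) ++ b     ≡⟨ solve (++-monoid Letter) ⟩
      invW b ++ (invW a ++ xA ++ a) ++ (xB ++ b)     ≈⟨ ≋-sandwich (invW b) (xB ++ b) a-conj ⟩
      invW b ++ yA ++ (xB ++ b)                      ≡⟨ solve (++-monoid Letter) ⟩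
      (invW b ++ yA) ++ xB ++ b                      ≈⟨ ≋-sandwich [] (xB ++ b) (sym (comm yA∈A (invW-over b∈B))) ⟩
      (yA ++ invW b) ++ xB ++ b                      ≡⟨ solve (++-monoid Letter) ⟩
      yA ++ (invW b ++ xB ++ b) ++ []                ≈⟨ ≋-sandwich yA [] b-conj ⟩
      yA ++ yB ++ []                                 ≡⟨ ≡.cong (yA ++_) (++-identityʳ yB) ⟩
      yA ++ yB                                       ∎

    conjIn-product : ∀ {xA xB yA yB} → AllIn B xB → AllIn A yA →
                     ConjIn A xA yA → ConjIn B xB yB → Conj (xA ++ xB) (yA ++ yB)
    conjIn-product xB∈B yA∈A (a , a∈A , a-conj) (b , b∈B , b-conj) =
      a ++ b , over-⊤ (a ++ b) , conj-product a∈A b∈B xB∈B yA∈A (≋-weaken a-conj) (≋-weaken b-conj)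

lemma8 : ∀ {c ℓ : Level} (n : ℕ) (I : Fin n → Fin n → Set) →
           (∀ α → ¬ I α α) → (∀ α β → I α β → I β α) →
           (G : Fin n → Group c ℓ) →
           (∀ α → ∃ λ g → ¬ Group._≈_ (G α) g (Group.ε (G α))) →
           (A B : Subset n) → (∀ α β → α ∈ A → β ∈ B → I α β) →
           let open GP I G in
           (x y xA xB yA yB : Word) →
           Reduced x → Reduced y →
           HasAl x (A ∪ B) → HasAl y (A ∪ B) →
           HasAl xA A → HasAl yA A → HasAl xB B → HasAl yB B →
           x ≋ (xA ++ xB) → y ≋ (yA ++ yB) →
           (Conj x y ⇔ (Conj xA yA × Conj xB yB)) ×
           (Conj xA yA ⇔ ConjIn A xA yA) ×
           (Conj xB yB ⇔ ConjIn B xB yB)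
lemma8 n I irrefl _ G _ A B A×B⊆I x y xA xB yA yB _ _ _ _ al-xA al-yA al-xB al-yB x≋ y≋ =
  mk⇔ project combine , conj⇔conjIn xA∈A yA∈A , conj⇔conjIn xB∈B yB∈B
  where
    open GP I G
    open GraphProductWords I G
    open Independent A B A×B⊆I

    xA∈A : AllIn A xA
    xA∈A = over-alphabet al-xA
    yA∈A : AllIn A yA
    yA∈A = over-alphabet al-yA
    xB∈B : AllIn B xB
    xB∈B = over-alphabet al-xB
    yB∈B : AllIn B yB
    yB∈B = over-alphabet al-yB

    A-avoids-B : ∀ {w} → AllIn A w → Avoids B w
    A-avoids-B = avoids-disjoint (disjoint irrefl)
    B-avoids-A : ∀ {w} → AllIn B w → Avoids A w
    B-avoids-A = avoids-disjoint (λ α α∈B α∈A → disjoint irrefl α α∈A α∈B)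

    project : Conj x y → Conj xA yA × Conj xB yB
    project c =
      conj-resp (conjIn⇒conj (π-conj A c)) (π-factorˡ x≋ xA∈A (B-avoids-A xB∈B)) (π-factorˡ y≋ yA∈A (B-avoids-A yB∈B)) ,
      conj-resp (conjIn⇒conj (π-conj B c)) (π-factorʳ x≋ (A-avoids-B xA∈A) xB∈B) (π-factorʳ y≋ (A-avoids-B yA∈A) yB∈B)

    combine : Conj xA yA × Conj xB yB → Conj x y
    combine (cA , cB) = conj-resp
      (conjIn-product xB∈B yA∈A (Equivalence.to (conj⇔conjIn xA∈A yA∈A) cA) (Equivalence.to (conj⇔conjIn xB∈B yB∈B) cB))
      (sym x≋) (sym y≋)
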